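{- Let $B\subseteq K_n^{(2)}$ be a nonempty $2$-coboundary, $v\in V$ any vertex, and $G=\mathrm{Link}_v(B)$, viewed as a graph on $V\setminus\{v\}$. Then $B$ is a $2$-hypercut if and only if $G$ is V-connected.
   Context: $V$ is a finite set, $|V|=n$, $K_n^{(d)}$ the set of $(d+1)$-subsets of $V$. For $G\subseteq K_n^{(1)}$ (a graph on $V$), the $2$-coboundary induced by $G$ is the set of triangles (3-subsets) containing an odd number of edges of $G$. For $X\subseteq K_n^{(2)}$ and $v\in V$, $\mathrm{Link}_v(X)=\{\tau\in K_n^{(1)}: v\notin\tau,\ \tau\cup\{v\}\in X\}$. Let $M_2$ be the $\mathbb{Z}_2$-incidence matrix between edges and triangles. For $A\subseteq K_n^{(2)}$, $\sigma$ is null homologous relative to $A$ if $1_{\{\sigma\}}$ lies in the $\mathbb{Z}_2$-span of the columns of $M_2$ indexed by $A$; $\sigma_1\sim\sigma_2\bmod A$ if $1_{\{\sigma_1\}}-1_{\{\sigma_2\}}$ does. A $2$-hypercut is a nonempty $C\subseteq K_n^{(2)}$ such that no element is null homologous relative to $K_n^{(2)}\setminus C$ and all pairs of elements are $\sim\bmod(K_n^{(2)}\setminus C)$. In a graph $G$, two adjacent edges $(u,x),(u,y)$ are V-equivalent if $(x,y)\notin E(G)$; taking the reflexive-transitive closure of this relation, $G$ is V-connected if any two of its edges are V-equivalent. -}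

module Defs where

open import Data.Nat using (ℕ; zero; suc; _≡ᵇ_)
open import Data.Bool using (Bool; true; false; _∧_; _∨_; not; _xor_)
open import Data.Fin using (Fin)
open import Data.Vec using (Vec; []; _∷_; lookup)
open import Data.List using (List; []; _∷_; [_]; map; _++_; filterᵇ; foldr)
open import Data.Fin.Subset using (Subset; ⁅_⁆; _∪_; ∣_∣)
open import Data.Product using (Σ; ∃; _×_; _,_)
open import Relation.Binary.PropositionalEquality using (_≡_; _≢_)
open import Relation.Nullary using (¬_)
open import Relation.Binary.Construct.Closure.ReflexiveTransitive using (Star)

-- Vertex set V = Fin n.  A (d)-simplex is a subset of Fin n of size d+1
-- (Subset n = Vec Bool n, canonical, so _≡_ is set equality).
-- A set of simplices is a Boolean predicate on Subset n; only its values
-- on subsets of the relevant size matter.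

allSubsets : (n : ℕ) → List (Subset n)
allSubsets zero = [ [] ]
allSubsets (suc n) = map (true ∷_) (allSubsets n) ++ map (false ∷_) (allSubsets n)

isEdge : {n : ℕ} → Subset n → Bool
isEdge s = ∣ s ∣ ≡ᵇ 2

isTri : {n : ℕ} → Subset n → Bool
isTri s = ∣ s ∣ ≡ᵇ 3

edges : (n : ℕ) → List (Subset n)
edges n = filterᵇ isEdge (allSubsets n)

triangles : (n : ℕ) → List (Subset n)
triangles n = filterᵇ isTri (allSubsets n)

_⊆ᵇ_ : {n : ℕ} → Subset n → Subset n → Bool
[] ⊆ᵇ [] = true
(x ∷ s) ⊆ᵇ (y ∷ t) = (not x ∨ y) ∧ (s ⊆ᵇ t)

parity : List Bool → Bool
parity = foldr _xor_ false

EdgeSet : ℕ → Set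
EdgeSet n = Subset n → Bool

TriSet : ℕ → Set
TriSet n = Subset n → Bool

δ : {n : ℕ} → EdgeSet n → TriSet n
δ {n} G t = parity (map (λ e → G e ∧ (e ⊆ᵇ t)) (edges n))

Is2Coboundary : {n : ℕ} → TriSet n → Set
Is2Coboundary {n} B = Σ (EdgeSet n) λ G → (t : Subset n) → isTri t ≡ true → B t ≡ δ G t

NonemptyT : {n : ℕ} → TriSet n → Set
NonemptyT {n} B = Σ (Subset n) λ t → isTri t ≡ true × B t ≡ true

complementT : {n : ℕ} → TriSet n → TriSet n
complementT C t = not (C t)

-- boundary of a triangle σ: the column of M_2 indexed by σ (as a Z_2 vector on edges)
∂ : {n : ℕ} → Subset n → EdgeSet n
∂ σ e = e ⊆ᵇ σ

InSpan : {n : ℕ} → TriSet n → EdgeSet n → Set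
InSpan {n} A f =
  Σ (TriSet n) λ S →
    ((t : Subset n) → isTri t ≡ true → S t ≡ true → A t ≡ true) ×
    ((e : Subset n) → isEdge e ≡ true →
       f e ≡ parity (map (λ t → S t ∧ (e ⊆ᵇ t)) (triangles n)))

NullHomologous : {n : ℕ} → TriSet n → Subset n → Set
NullHomologous A σ = InSpan A (∂ σ)

HomEquiv : {n : ℕ} → TriSet n → Subset n → Subset n → Set
HomEquiv A σ₁ σ₂ = InSpan A (λ e → ∂ σ₁ e xor ∂ σ₂ e)

Is2Hypercut : {n : ℕ} → TriSet n → Set
Is2Hypercut {n} C =
  NonemptyT C ×
  ((σ : Subset n) → isTri σ ≡ true → C σ ≡ true → ¬ NullHomologous (complementT C) σ) ×
  ((σ₁ σ₂ : Subset n) → isTri σ₁ ≡ true → isTri σ₂ ≡ true →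
     C σ₁ ≡ true → C σ₂ ≡ true → HomEquiv (complementT C) σ₁ σ₂)

Link : {n : ℕ} → Fin n → TriSet n → EdgeSet n
Link v X τ = isEdge τ ∧ not (lookup τ v) ∧ X (τ ∪ ⁅ v ⁆)

edge : {n : ℕ} → Fin n → Fin n → Subset n
edge a b = ⁅ a ⁆ ∪ ⁅ b ⁆

VStep : {n : ℕ} → EdgeSet n → Subset n → Subset n → Set
VStep G e f =
  ∃ λ u → ∃ λ x → ∃ λ y →
    u ≢ x × u ≢ y × x ≢ y ×
    e ≡ edge u x × f ≡ edge u y ×
    G e ≡ true × G f ≡ true × G (edge x y) ≡ false

VEquivalent : {n : ℕ} → EdgeSet n → Subset n → Subset n → Set
VEquivalent G = Star (VStep G)

VConnected : {n : ℕ} → EdgeSet n → Set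
VConnected {n} G =
  (e f : Subset n) → isEdge e ≡ true → isEdge f ≡ true →
  G e ≡ true → G f ≡ true → VEquivalent G e f

module Submission where

-- Let A be the complement of B and ⟨H , f⟩ the Z₂-pairing of edge functions. Three facts drive it:
--   * adjointness ⟨H , ∂S⟩ = Σ_{t ∈ S} δH(t), so ⟨H , -⟩ vanishes on span(A) when δH vanishes on A;
--   * the boundary of a tetrahedron vanishes, so two faces are homologous mod A iff the other two are;
--   * a coboundary is the coboundary of its own link: B = δL.
-- (⇐) Pairing with L shows no triangle of B is null homologous. A V-step from ux to uy makes the cones
-- uxv, uyv homologous (the faces uxy, xyv lie in A), and each triangle of B is homologous to the cone
-- over some link edge, so V-connectivity makes all triangles of B homologous.
-- (⇒) If link edges e, f were not V-equivalent, the V-class K of e (decidable, as reachability in a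
-- finite set is) has δK ⊆ δL = B; hence ⟨K , -⟩ kills ∂(e ∪ v) + ∂(f ∪ v) ∈ span(A), yet equals K e + K f = 1.
-- The file proves, in order: Boolean identities by truth tables; Z₂-sums over lists; edges and
-- triangles as subsets of Fin n; ∂, δ and the pairing; spans and homology; decidable reachability;
-- V-steps; links; and finally the two directions and the theorem.

open import Defs
open import Data.Nat using (ℕ; zero; suc; _≤_; _<_; z≤n; s≤s)
open import Data.Nat.Properties using (suc-injective; ≤-trans; <-irrefl; m≤n⇒m≤1+n; ≡ᵇ⇒≡)
open import Data.Bool using (Bool; true; false; _∧_; _∨_; not; _xor_; T; if_then_else_)
import Data.Bool.Properties as Bool
open import Data.Bool.Properties
  using (xor-assoc; xor-comm; xor-identityʳ; xor-same; ∧-comm; ∧-zeroʳ; ∧-identityʳ;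
         ∧-conicalˡ; ∧-conicalʳ; ∧-distribˡ-xor; ∧-distribʳ-xor)
open import Data.List using (List; []; _∷_; map; _++_; filterᵇ; length)
open import Data.Bool.ListAction using (any)
open import Data.List.Properties using (map-∘)
open import Data.List.Membership.Propositional using (_∈_)
open import Data.List.Membership.Propositional.Properties using (∈-++⁺ˡ; ∈-++⁺ʳ; ∈-map⁺)
open import Data.List.Relation.Unary.Any using (here; there)
open import Data.List.Relation.Unary.All as All using (All; []; _∷_)
open import Data.Fin using (Fin; zero; suc)
import Data.Fin.Properties as Fin
open import Data.Vec using ([]; _∷_; lookup)
open import Data.Vec.Properties using (lookup-zipWith; ≡-dec)
open import Data.Fin.Subset using (Subset; ⁅_⁆; _∪_; ∣_∣; ⊥)
open import Data.Fin.Subset.Properties using (∪-identityʳ; ∪-identityˡ; ∪-assoc; ∪-comm; ∣⁅x⁆∣≡1)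
open import Data.Product using (Σ; _×_; _,_; proj₁; proj₂)
open import Data.Sum using (_⊎_; inj₁; inj₂)
open import Data.Empty using (⊥-elim)
open import Function.Bundles using (_⇔_; mk⇔)
open import Relation.Nullary using (¬_; Dec; yes; no; does; ¬?)
open import Relation.Nullary.Decidable using (_×-dec_; dec-true; dec-false; does-⇔)
open import Relation.Binary.Definitions using (DecidableEquality)
open import Relation.Binary.PropositionalEquality
open import Relation.Binary.Construct.Closure.ReflexiveTransitive using (Star; ε; _◅_; _◅◅_)

Formula : ℕ → Set
Formula zero    = Bool
Formula (suc k) = Bool → Formula k

Entails : (k : ℕ) → Formula k → Formula k → Formula k → Set
Entails zero    h f g = h ≡ false → f ≡ g
Entails (suc k) h f g = (x : Bool) → Entails k (h x) (f x) (g x)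

entails? : (k : ℕ) → Formula k → Formula k → Formula k → Bool
entails? zero    h f g = h ∨ not (f xor g)
entails? (suc k) h f g =
  entails? k (h true) (f true) (g true) ∧ entails? k (h false) (f false) (g false)

truthTable : (k : ℕ) (h f g : Formula k) → entails? k h f g ≡ true → Entails k h f g
truthTable zero    false false false _  _ = refl
truthTable zero    false true  true  _  _ = refl
truthTable zero    false false true  () _
truthTable zero    false true  false () _
truthTable zero    true  f     g     _  ()
truthTable (suc k) h f g ok true  = truthTable k _ _ _ (∧-conicalˡ _ _ ok)
truthTable (suc k) h f g ok false = truthTable k _ _ _ (∧-conicalʳ _ _ ok)

never : (k : ℕ) → Formula k
never zero    = false
never (suc k) = λ _ → never k

Identity : (k : ℕ) → Formula k → Formula k → Set
Identity zero    f g = f ≡ g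
Identity (suc k) f g = (x : Bool) → Identity k (f x) (g x)

identity : (k : ℕ) (f g : Formula k) → entails? k (never k) f g ≡ true → Identity k f g
identity zero    f g ok       = truthTable zero false f g ok refl
identity (suc k) f g ok true  = identity k (f true) (g true) (∧-conicalˡ _ _ ok)
identity (suc k) f g ok false = identity k (f false) (g false) (∧-conicalʳ _ _ ok)

xor-interchange : ∀ a b c d → (a xor b) xor (c xor d) ≡ (a xor c) xor (b xor d)
xor-interchange = identity 4 _ _ refl

xor-telescope : ∀ a b c → (a xor b) xor (b xor c) ≡ a xor c
xor-telescope = identity 3 _ _ refl

∧-exchange : ∀ a b c → a ∧ (b ∧ c) ≡ b ∧ (a ∧ c)
∧-exchange = identity 3 _ _ refl

false≢true : false ≢ true
false≢true ()

module _ {A : Set} where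

  parity-zero : (xs : List A) → parity (map (λ _ → false) xs) ≡ false
  parity-zero []       = refl
  parity-zero (x ∷ xs) = parity-zero xs

  parity-cong : {f g : A → Bool} → (∀ x → f x ≡ g x) → (xs : List A) →
    parity (map f xs) ≡ parity (map g xs)
  parity-cong f≗g []       = refl
  parity-cong f≗g (x ∷ xs) = cong₂ _xor_ (f≗g x) (parity-cong f≗g xs)

  parity-cong-filter : (P : A → Bool) {f g : A → Bool} → (∀ x → P x ≡ true → f x ≡ g x) →
    (xs : List A) → parity (map f (filterᵇ P xs)) ≡ parity (map g (filterᵇ P xs))
  parity-cong-filter P f≗g []       = refl
  parity-cong-filter P f≗g (x ∷ xs) with P x in Px
  ... | true  = cong₂ _xor_ (f≗g x Px) (parity-cong-filter P f≗g xs)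
  ... | false = parity-cong-filter P f≗g xs

  parity-++ : (f : A → Bool) (xs ys : List A) →
    parity (map f (xs ++ ys)) ≡ parity (map f xs) xor parity (map f ys)
  parity-++ f []       ys = refl
  parity-++ f (x ∷ xs) ys = trans (cong (f x xor_) (parity-++ f xs ys)) (sym (xor-assoc (f x) _ _))

  parity-xor : (f g : A → Bool) (xs : List A) →
    parity (map (λ x → f x xor g x) xs) ≡ parity (map f xs) xor parity (map g xs)
  parity-xor f g []       = refl
  parity-xor f g (x ∷ xs) =
    trans (cong ((f x xor g x) xor_) (parity-xor f g xs)) (xor-interchange (f x) (g x) _ _)

  parity-scaleˡ : (c : Bool) (f : A → Bool) (xs : List A) →
    parity (map (λ x → c ∧ f x) xs) ≡ c ∧ parity (map f xs)
  parity-scaleˡ false f xs = parity-zero xs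
  parity-scaleˡ true  f xs = refl

  parity-scaleʳ : (c : Bool) (f : A → Bool) (xs : List A) →
    parity (map (λ x → f x ∧ c) xs) ≡ parity (map f xs) ∧ c
  parity-scaleʳ c f xs =
    trans (parity-cong (λ x → ∧-comm (f x) c) xs) (trans (parity-scaleˡ c f xs) (∧-comm c _))

  parity-filter : (P f : A → Bool) (xs : List A) →
    parity (map f (filterᵇ P xs)) ≡ parity (map (λ x → P x ∧ f x) xs)
  parity-filter P f []       = refl
  parity-filter P f (x ∷ xs) with P x
  ... | true  = cong (f x xor_) (parity-filter P f xs)
  ... | false = parity-filter P f xs

  parity-witness : (f : A → Bool) (xs : List A) → parity (map f xs) ≡ true →
    Σ A λ x → x ∈ xs × f x ≡ true
  parity-witness f []       ()
  parity-witness f (x ∷ xs) sum≡true with f x in fx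
  ... | true  = x , here refl , fx
  ... | false with parity-witness f xs sum≡true
  ...   | y , y∈xs , fy = y , there y∈xs , fy

module _ {A B : Set} where

  parity-map : (f : B → Bool) (g : A → B) (xs : List A) →
    parity (map f (map g xs)) ≡ parity (map (λ x → f (g x)) xs)
  parity-map f g xs = cong parity (sym (map-∘ xs))

  parity-swap : (f : A → B → Bool) (xs : List A) (ys : List B) →
    parity (map (λ x → parity (map (f x) ys)) xs) ≡ parity (map (λ y → parity (map (λ x → f x y) xs)) ys)
  parity-swap f []       ys = sym (parity-zero ys)
  parity-swap f (x ∷ xs) ys =
    trans (cong (parity (map (f x) ys) xor_) (parity-swap f xs ys))
          (sym (parity-xor (f x) (λ y → parity (map (λ x → f x y) xs)) ys))

_≟ˢ_ : {n : ℕ} → DecidableEquality (Subset n)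
_≟ˢ_ = ≡-dec Bool._≟_

_==_ : {n : ℕ} → Subset n → Subset n → Bool
s == t = does (s ≟ˢ t)

_=ᶠ_ : {n : ℕ} → Fin n → Fin n → Bool
a =ᶠ b = does (a Fin.≟ b)

==⇒≡ : {n : ℕ} {s t : Subset n} → s == t ≡ true → s ≡ t
==⇒≡ {s = s} {t} eq with s ≟ˢ t
... | yes s≡t = s≡t

=ᶠ⇒≡ : {n : ℕ} {a b : Fin n} → a =ᶠ b ≡ true → a ≡ b
=ᶠ⇒≡ {a = a} {b} eq with a Fin.≟ b
... | yes a≡b = a≡b

allSubsets-complete : {n : ℕ} (s : Subset n) → s ∈ allSubsets n
allSubsets-complete []                = here refl
allSubsets-complete {suc n} (true ∷ s)  = ∈-++⁺ˡ (∈-map⁺ (true ∷_) (allSubsets-complete s))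
allSubsets-complete {suc n} (false ∷ s) =
  ∈-++⁺ʳ (map (true ∷_) (allSubsets n)) (∈-map⁺ (false ∷_) (allSubsets-complete s))

pick : {n : ℕ} (p : Subset n) (g : Subset n → Bool) →
  parity (map (λ s → (s == p) ∧ g s) (allSubsets n)) ≡ g p
pick []          g = xor-identityʳ (g [])
pick {suc n} (true ∷ p) g = begin
  parity (map _ (map (true ∷_) S ++ map (false ∷_) S))
    ≡⟨ parity-++ _ (map (true ∷_) S) (map (false ∷_) S) ⟩
  parity (map _ (map (true ∷_) S)) xor parity (map _ (map (false ∷_) S))
    ≡⟨ cong₂ _xor_ (parity-map _ (true ∷_) S) (parity-map _ (false ∷_) S) ⟩
  parity (map (λ s → (s == p) ∧ g (true ∷ s)) S) xor parity (map (λ _ → false) S)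
    ≡⟨ cong₂ _xor_ (pick p (λ s → g (true ∷ s))) (parity-zero S) ⟩
  g (true ∷ p) xor false
    ≡⟨ xor-identityʳ _ ⟩
  g (true ∷ p) ∎
  where open ≡-Reasoning; S = allSubsets n
pick {suc n} (false ∷ p) g = begin
  parity (map _ (map (true ∷_) S ++ map (false ∷_) S))
    ≡⟨ parity-++ _ (map (true ∷_) S) (map (false ∷_) S) ⟩
  parity (map _ (map (true ∷_) S)) xor parity (map _ (map (false ∷_) S))
    ≡⟨ cong₂ _xor_ (parity-map _ (true ∷_) S) (parity-map _ (false ∷_) S) ⟩
  parity (map (λ _ → false) S) xor parity (map (λ s → (s == p) ∧ g (false ∷ s)) S)
    ≡⟨ cong₂ _xor_ (parity-zero S) (pick p (λ s → g (false ∷ s))) ⟩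
  g (false ∷ p) ∎
  where open ≡-Reasoning; S = allSubsets n

pick-filtered : {n : ℕ} (P : Subset n → Bool) (p : Subset n) → P p ≡ true → (g : Subset n → Bool) →
  parity (map (λ s → (s == p) ∧ g s) (filterᵇ P (allSubsets n))) ≡ g p
pick-filtered {n} P p Pp g = begin
  parity (map (λ s → (s == p) ∧ g s) (filterᵇ P (allSubsets n)))
    ≡⟨ parity-filter P _ (allSubsets n) ⟩
  parity (map (λ s → P s ∧ ((s == p) ∧ g s)) (allSubsets n))
    ≡⟨ parity-cong (λ s → ∧-exchange (P s) (s == p) (g s)) (allSubsets n) ⟩
  parity (map (λ s → (s == p) ∧ (P s ∧ g s)) (allSubsets n))
    ≡⟨ pick p (λ s → P s ∧ g s) ⟩
  P p ∧ g p
    ≡⟨ cong (_∧ g p) Pp ⟩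
  g p ∎
  where open ≡-Reasoning

lookup-⊥ : {n : ℕ} (x : Fin n) → lookup (⊥ {n}) x ≡ false
lookup-⊥ zero    = refl
lookup-⊥ (suc x) = lookup-⊥ x

lookup-⁅⁆ : {n : ℕ} (a x : Fin n) → lookup ⁅ a ⁆ x ≡ a =ᶠ x
lookup-⁅⁆ zero    zero    = refl
lookup-⁅⁆ zero    (suc x) = lookup-⊥ x
lookup-⁅⁆ (suc a) zero    = refl
lookup-⁅⁆ (suc a) (suc x) = lookup-⁅⁆ a x

lookup-∪ : {n : ℕ} (s t : Subset n) (x : Fin n) → lookup (s ∪ t) x ≡ lookup s x ∨ lookup t x
lookup-∪ s t x = lookup-zipWith _∨_ x s t

=ᶠ-refl : {n : ℕ} (a : Fin n) → a =ᶠ a ≡ true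
=ᶠ-refl a = dec-true (a Fin.≟ a) refl

=ᶠ-≢ : {n : ℕ} {a b : Fin n} → a ≢ b → a =ᶠ b ≡ false
=ᶠ-≢ {a = a} {b} a≢b = dec-false (a Fin.≟ b) a≢b

tri : {n : ℕ} → Fin n → Fin n → Fin n → Subset n
tri a b c = ⁅ a ⁆ ∪ ⁅ b ⁆ ∪ ⁅ c ⁆

lookup-edge : {n : ℕ} (a b x : Fin n) → lookup (edge a b) x ≡ a =ᶠ x ∨ b =ᶠ x
lookup-edge a b x = trans (lookup-∪ ⁅ a ⁆ ⁅ b ⁆ x) (cong₂ _∨_ (lookup-⁅⁆ a x) (lookup-⁅⁆ b x))

lookup-tri : {n : ℕ} (a b c x : Fin n) → lookup (tri a b c) x ≡ a =ᶠ x ∨ b =ᶠ x ∨ c =ᶠ x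
lookup-tri a b c x = trans (lookup-∪ ⁅ a ⁆ (edge b c) x) (cong₂ _∨_ (lookup-⁅⁆ a x) (lookup-edge b c x))

lookup-self : {n : ℕ} (x : Fin n) (s : Subset n) → lookup (⁅ x ⁆ ∪ s) x ≡ true
lookup-self x s = trans (lookup-∪ ⁅ x ⁆ s x) (cong (_∨ lookup s x) (trans (lookup-⁅⁆ x x) (=ᶠ-refl x)))

edge-sym : {n : ℕ} (a b : Fin n) → edge a b ≡ edge b a
edge-sym a b = ∪-comm ⁅ a ⁆ ⁅ b ⁆

tri-swap₁₂ : {n : ℕ} (a b c : Fin n) → tri a b c ≡ tri b a c
tri-swap₁₂ a b c =
  trans (sym (∪-assoc ⁅ a ⁆ ⁅ b ⁆ ⁅ c ⁆)) (trans (cong (_∪ ⁅ c ⁆) (∪-comm ⁅ a ⁆ ⁅ b ⁆)) (∪-assoc ⁅ b ⁆ ⁅ a ⁆ ⁅ c ⁆))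

tri-swap₂₃ : {n : ℕ} (a b c : Fin n) → tri a b c ≡ tri a c b
tri-swap₂₃ a b c = cong (⁅ a ⁆ ∪_) (∪-comm ⁅ b ⁆ ⁅ c ⁆)

cone : {n : ℕ} (a b v : Fin n) → edge a b ∪ ⁅ v ⁆ ≡ tri a b v
cone a b v = ∪-assoc ⁅ a ⁆ ⁅ b ⁆ ⁅ v ⁆

⊆ᵇ-⊥ : {n : ℕ} (t : Subset n) → ⊥ ⊆ᵇ t ≡ true
⊆ᵇ-⊥ []      = refl
⊆ᵇ-⊥ (x ∷ t) = ⊆ᵇ-⊥ t

⊆ᵇ-⁅⁆∪ : {n : ℕ} (x : Fin n) (s t : Subset n) → (⁅ x ⁆ ∪ s) ⊆ᵇ t ≡ lookup t x ∧ (s ⊆ᵇ t)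
⊆ᵇ-⁅⁆∪ zero (a ∷ s) (b ∷ t) rewrite ∪-identityˡ s with a | b
... | true  | true  = refl
... | true  | false = refl
... | false | true  = refl
... | false | false = refl
⊆ᵇ-⁅⁆∪ (suc x) (a ∷ s) (b ∷ t) rewrite ⊆ᵇ-⁅⁆∪ x s t with a | b | lookup t x
... | true  | true  | c     = refl
... | true  | false | true  = refl
... | true  | false | false = refl
... | false | _     | _     = refl

⊆ᵇ-edge : {n : ℕ} (x y : Fin n) (t : Subset n) → edge x y ⊆ᵇ t ≡ lookup t x ∧ lookup t y
⊆ᵇ-edge x y t = begin
  edge x y ⊆ᵇ t                        ≡⟨ ⊆ᵇ-⁅⁆∪ x ⁅ y ⁆ t ⟩
  lookup t x ∧ (⁅ y ⁆ ⊆ᵇ t)            ≡⟨ cong (λ s → lookup t x ∧ (s ⊆ᵇ t)) (sym (∪-identityʳ ⁅ y ⁆)) ⟩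
  lookup t x ∧ ((⁅ y ⁆ ∪ ⊥) ⊆ᵇ t)      ≡⟨ cong (lookup t x ∧_) (⊆ᵇ-⁅⁆∪ y ⊥ t) ⟩
  lookup t x ∧ (lookup t y ∧ (⊥ ⊆ᵇ t)) ≡⟨ cong (λ b → lookup t x ∧ (lookup t y ∧ b)) (⊆ᵇ-⊥ t) ⟩
  lookup t x ∧ (lookup t y ∧ true)     ≡⟨ cong (lookup t x ∧_) (∧-identityʳ _) ⟩
  lookup t x ∧ lookup t y              ∎
  where open ≡-Reasoning

⊆ᵇ-refl : {n : ℕ} (s : Subset n) → s ⊆ᵇ s ≡ true
⊆ᵇ-refl []          = refl
⊆ᵇ-refl (true ∷ s)  = ⊆ᵇ-refl s
⊆ᵇ-refl (false ∷ s) = ⊆ᵇ-refl s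

⊆ᵇ-size : {n : ℕ} (s t : Subset n) → s ⊆ᵇ t ≡ true → ∣ s ∣ ≤ ∣ t ∣
⊆ᵇ-size []          []          _   = z≤n
⊆ᵇ-size (true ∷ s)  (true ∷ t)  s⊆t = s≤s (⊆ᵇ-size s t s⊆t)
⊆ᵇ-size (false ∷ s) (true ∷ t)  s⊆t = m≤n⇒m≤1+n (⊆ᵇ-size s t s⊆t)
⊆ᵇ-size (false ∷ s) (false ∷ t) s⊆t = ⊆ᵇ-size s t s⊆t
⊆ᵇ-size (true ∷ s)  (false ∷ t) ()

⊆ᵇ-size-≡ : {n : ℕ} (s t : Subset n) → s ⊆ᵇ t ≡ true → ∣ s ∣ ≡ ∣ t ∣ → s ≡ t
⊆ᵇ-size-≡ []          []          _   _  = refl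
⊆ᵇ-size-≡ (true ∷ s)  (true ∷ t)  s⊆t eq = cong (true ∷_) (⊆ᵇ-size-≡ s t s⊆t (suc-injective eq))
⊆ᵇ-size-≡ (false ∷ s) (false ∷ t) s⊆t eq = cong (false ∷_) (⊆ᵇ-size-≡ s t s⊆t eq)
⊆ᵇ-size-≡ (true ∷ s)  (false ∷ t) ()  _
⊆ᵇ-size-≡ (false ∷ s) (true ∷ t)  s⊆t eq = ⊥-elim (<-irrefl eq (s≤s (⊆ᵇ-size s t s⊆t)))

size-⁅⁆∪ : {n : ℕ} (x : Fin n) (s : Subset n) → lookup s x ≡ false → ∣ ⁅ x ⁆ ∪ s ∣ ≡ suc ∣ s ∣
size-⁅⁆∪ zero    (false ∷ s) _   rewrite ∪-identityˡ s = refl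
size-⁅⁆∪ (suc x) (true ∷ s)  x∉s = cong suc (size-⁅⁆∪ x s x∉s)
size-⁅⁆∪ (suc x) (false ∷ s) x∉s = size-⁅⁆∪ x s x∉s

size-zero : {n : ℕ} (s : Subset n) → ∣ s ∣ ≡ 0 → s ≡ ⊥
size-zero []          _  = refl
size-zero (false ∷ s) eq = cong (false ∷_) (size-zero s eq)
size-zero (true ∷ s)  ()

record Removal {n : ℕ} (s : Subset n) (k : ℕ) : Set where
  constructor removal
  field
    point : Fin n
    rest  : Subset n
    split : s ≡ ⁅ point ⁆ ∪ rest
    fresh : lookup rest point ≡ false
    size  : ∣ rest ∣ ≡ k

remove : {n k : ℕ} (s : Subset n) → ∣ s ∣ ≡ suc k → Removal s k
remove (true ∷ s)  eq = removal zero (false ∷ s) (cong (true ∷_) (sym (∪-identityˡ s))) refl (suc-injective eq)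
remove (false ∷ s) eq with remove s eq
... | removal x r split fresh size = removal (suc x) (false ∷ r) (cong (false ∷_) split) fresh size

singleton : {n : ℕ} (s : Subset n) → ∣ s ∣ ≡ 1 → Σ (Fin n) λ x → s ≡ ⁅ x ⁆
singleton s size-s with remove s size-s
... | removal x r split _ size =
  x , trans split (trans (cong (⁅ x ⁆ ∪_) (size-zero r size)) (∪-identityʳ ⁅ x ⁆))

pair : {n : ℕ} (s : Subset n) → ∣ s ∣ ≡ 2 → Σ (Fin n) λ a → Σ (Fin n) λ b → a ≢ b × s ≡ edge a b
pair s size-s with remove s size-s
... | removal a r split fresh size with singleton r size
...   | b , refl = a , b , a≢b , split
  where
  a≢b : a ≢ b
  a≢b refl = false≢true (trans (sym fresh) (trans (lookup-⁅⁆ a a) (=ᶠ-refl a)))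

size-edge : {n : ℕ} (e : Subset n) → isEdge e ≡ true → ∣ e ∣ ≡ 2
size-edge e is-edge = ≡ᵇ⇒≡ ∣ e ∣ 2 (subst T (sym is-edge) _)

edge-view : {n : ℕ} (e : Subset n) → isEdge e ≡ true → Σ (Fin n) λ a → Σ (Fin n) λ b → a ≢ b × e ≡ edge a b
edge-view e is-edge = pair e (size-edge e is-edge)

record TriangleView {n : ℕ} (t : Subset n) : Set where
  constructor triangleView
  field
    a b c : Fin n
    a≢b   : a ≢ b
    b≢c   : b ≢ c
    a≢c   : a ≢ c
    shape : t ≡ tri a b c

triangle-view : {n : ℕ} (t : Subset n) → isTri t ≡ true → TriangleView t
triangle-view t is-tri with remove t (≡ᵇ⇒≡ ∣ t ∣ 3 (subst T (sym is-tri) _))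
... | removal a r split fresh size with pair r size
...   | b , c , b≢c , refl = triangleView a b c a≢b b≢c a≢c split
  where
  a≢b : a ≢ b
  a≢b refl = false≢true (trans (sym fresh) (lookup-self a ⁅ c ⁆))
  a≢c : a ≢ c
  a≢c refl = false≢true (trans (sym fresh) (trans (cong (λ s → lookup s a) (edge-sym b a)) (lookup-self a ⁅ b ⁆)))

isEdge-edge : {n : ℕ} {x y : Fin n} → x ≢ y → isEdge (edge x y) ≡ true
isEdge-edge {x = x} {y} x≢y
  rewrite size-⁅⁆∪ x ⁅ y ⁆ (trans (lookup-⁅⁆ y x) (=ᶠ-≢ (≢-sym x≢y))) | ∣⁅x⁆∣≡1 y = refl

isTri-tri : {n : ℕ} {a b c : Fin n} → a ≢ b → b ≢ c → a ≢ c → isTri (tri a b c) ≡ true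
isTri-tri {a = a} {b} {c} a≢b b≢c a≢c
  rewrite size-⁅⁆∪ a (edge b c) (trans (lookup-edge b c a) (cong₂ _∨_ (=ᶠ-≢ (≢-sym a≢b)) (=ᶠ-≢ (≢-sym a≢c))))
        | size-⁅⁆∪ b ⁅ c ⁆ (trans (lookup-⁅⁆ c b) (=ᶠ-≢ (≢-sym b≢c))) | ∣⁅x⁆∣≡1 c = refl

⊆ᵇ-edges : {n : ℕ} (e p : Subset n) → isEdge e ≡ true → isEdge p ≡ true → e ⊆ᵇ p ≡ e == p
⊆ᵇ-edges e p e-edge p-edge with e ⊆ᵇ p in e⊆p
... | true  = sym (dec-true (e ≟ˢ p) (⊆ᵇ-size-≡ e p e⊆p (trans (size-edge e e-edge) (sym (size-edge p p-edge)))))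
... | false = sym (dec-false (e ≟ˢ p) λ { refl → false≢true (trans (sym e⊆p) (⊆ᵇ-refl e)) })

=ᶠ-disjointˡ : {n : ℕ} {a b : Fin n} → a ≢ b → ∀ x → (a =ᶠ x) ∧ (b =ᶠ x) ≡ false
=ᶠ-disjointˡ {a = a} {b} a≢b x with a =ᶠ x in ax | b =ᶠ x in bx
... | true  | true  = ⊥-elim (a≢b (trans (=ᶠ⇒≡ {a = a} {x} ax) (sym (=ᶠ⇒≡ {a = b} {x} bx))))
... | true  | false = refl
... | false | _     = refl

=ᶠ-disjointʳ : {n : ℕ} {x y : Fin n} → x ≢ y → ∀ a → (a =ᶠ x) ∧ (a =ᶠ y) ≡ false
=ᶠ-disjointʳ {x = x} {y} x≢y a with a =ᶠ x in ax | a =ᶠ y in ay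
... | true  | true  = ⊥-elim (x≢y (trans (sym (=ᶠ⇒≡ {a = a} {x} ax)) (=ᶠ⇒≡ {a = a} {y} ay)))
... | true  | false = refl
... | false | _     = refl

-- Incidence of an edge xy in a triangle abc, in terms of vertex coincidences:
-- the edge lies in the triangle iff it is one of the three sides.
incidence : ∀ xa xb xc ya yb yc →
  (xa ∧ xb) ∨ (xb ∧ xc) ∨ (xa ∧ xc) ∨ (ya ∧ yb) ∨ (yb ∧ yc) ∨ (ya ∧ yc) ∨ (xa ∧ ya) ∨ (xb ∧ yb) ∨ (xc ∧ yc) ≡ false →
  (xa ∨ xb ∨ xc) ∧ (ya ∨ yb ∨ yc) ≡
    ((xa ∨ xb) ∧ (ya ∨ yb)) xor ((xb ∨ xc) ∧ (yb ∨ yc)) xor ((xa ∨ xc) ∧ (ya ∨ yc))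
incidence = truthTable 6 _ _ _ refl

∂-tri : {n : ℕ} {a b c : Fin n} (e : Subset n) → isEdge e ≡ true → a ≢ b → b ≢ c → a ≢ c →
  ∂ (tri a b c) e ≡ (e == edge a b) xor (e == edge b c) xor (e == edge a c)
∂-tri {a = a} {b} {c} e e-edge a≢b b≢c a≢c with edge-view e e-edge
... | x , y , x≢y , refl = begin
  e ⊆ᵇ tri a b c
    ≡⟨ sides ⟩
  (e ⊆ᵇ edge a b) xor (e ⊆ᵇ edge b c) xor (e ⊆ᵇ edge a c)
    ≡⟨ cong₂ _xor_ (side a≢b) (cong₂ _xor_ (side b≢c) (side a≢c)) ⟩
  (e == edge a b) xor (e == edge b c) xor (e == edge a c) ∎
  where
  open ≡-Reasoning
  side : {p q : Fin _} → p ≢ q → e ⊆ᵇ edge p q ≡ e == edge p q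
  side p≢q = ⊆ᵇ-edges e _ e-edge (isEdge-edge p≢q)
  sides : e ⊆ᵇ tri a b c ≡ (e ⊆ᵇ edge a b) xor (e ⊆ᵇ edge b c) xor (e ⊆ᵇ edge a c)
  sides rewrite ⊆ᵇ-edge x y (tri a b c) | ⊆ᵇ-edge x y (edge a b) | ⊆ᵇ-edge x y (edge b c) | ⊆ᵇ-edge x y (edge a c)
              | lookup-tri a b c x | lookup-tri a b c y | lookup-edge a b x | lookup-edge a b y
              | lookup-edge b c x | lookup-edge b c y | lookup-edge a c x | lookup-edge a c y =
    incidence (a =ᶠ x) (b =ᶠ x) (c =ᶠ x) (a =ᶠ y) (b =ᶠ y) (c =ᶠ y)
      (cong₂ _∨_ (=ᶠ-disjointˡ a≢b x) (cong₂ _∨_ (=ᶠ-disjointˡ b≢c x) (cong₂ _∨_ (=ᶠ-disjointˡ a≢c x)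
      (cong₂ _∨_ (=ᶠ-disjointˡ a≢b y) (cong₂ _∨_ (=ᶠ-disjointˡ b≢c y) (cong₂ _∨_ (=ᶠ-disjointˡ a≢c y)
      (cong₂ _∨_ (=ᶠ-disjointʳ x≢y a) (cong₂ _∨_ (=ᶠ-disjointʳ x≢y b) (=ᶠ-disjointʳ x≢y c)))))))))

pick-edge : {n : ℕ} (H : EdgeSet n) (p : Subset n) → isEdge p ≡ true →
  parity (map (λ e → H e ∧ (e == p)) (edges n)) ≡ H p
pick-edge {n} H p p-edge =
  trans (parity-cong (λ e → ∧-comm (H e) (e == p)) (edges n)) (pick-filtered isEdge p p-edge H)

δ-tri : {n : ℕ} (H : EdgeSet n) {a b c : Fin n} → a ≢ b → b ≢ c → a ≢ c →
  δ H (tri a b c) ≡ H (edge a b) xor H (edge b c) xor H (edge a c)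
δ-tri {n} H {a} {b} {c} a≢b b≢c a≢c = begin
  δ H (tri a b c)
    ≡⟨ parity-cong-filter isEdge (λ e e-edge → trans (cong (H e ∧_) (∂-tri e e-edge a≢b b≢c a≢c))
                                                      (∧-distrib₃ (H e) _ _ _)) (allSubsets n) ⟩
  parity (map (λ e → side ab e xor side bc e xor side ac e) (edges n))
    ≡⟨ parity-xor (side ab) _ (edges n) ⟩
  parity (map (side ab) (edges n)) xor parity (map (λ e → side bc e xor side ac e) (edges n))
    ≡⟨ cong (parity (map (side ab) (edges n)) xor_) (parity-xor (side bc) (side ac) (edges n)) ⟩
  parity (map (side ab) (edges n)) xor parity (map (side bc) (edges n)) xor parity (map (side ac) (edges n))
    ≡⟨ cong₂ _xor_ (pick-edge H ab (isEdge-edge a≢b))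
                   (cong₂ _xor_ (pick-edge H bc (isEdge-edge b≢c)) (pick-edge H ac (isEdge-edge a≢c))) ⟩
  H ab xor H bc xor H ac ∎
  where
  open ≡-Reasoning
  ab = edge a b
  bc = edge b c
  ac = edge a c
  side : Subset n → Subset n → Bool
  side s e = H e ∧ (e == s)
  ∧-distrib₃ : ∀ h x y z → h ∧ (x xor y xor z) ≡ (h ∧ x) xor (h ∧ y) xor (h ∧ z)
  ∧-distrib₃ = identity 4 _ _ refl

⟨_,_⟩ : {n : ℕ} → EdgeSet n → EdgeSet n → Bool
⟨_,_⟩ {n} H f = parity (map (λ e → H e ∧ f e) (edges n))

pairing-xor : {n : ℕ} (H f g : EdgeSet n) → ⟨ H , (λ e → f e xor g e) ⟩ ≡ ⟨ H , f ⟩ xor ⟨ H , g ⟩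
pairing-xor {n} H f g =
  trans (parity-cong (λ e → ∧-distribˡ-xor (H e) (f e) (g e)) (edges n)) (parity-xor _ _ (edges n))

-- Adjointness of ∂ and δ: pairing H with the boundary of a set S of triangles
-- is summing δH over S.
pairing-∂ : {n : ℕ} (H : EdgeSet n) (S : TriSet n) (f : EdgeSet n) →
  (∀ e → isEdge e ≡ true → f e ≡ parity (map (λ t → S t ∧ (e ⊆ᵇ t)) (triangles n))) →
  ⟨ H , f ⟩ ≡ parity (map (λ t → S t ∧ δ H t) (triangles n))
pairing-∂ {n} H S f f≡∂S = begin
  ⟨ H , f ⟩
    ≡⟨ parity-cong-filter isEdge (λ e e-edge → cong (H e ∧_) (f≡∂S e e-edge)) (allSubsets n) ⟩
  parity (map (λ e → H e ∧ parity (map (λ t → S t ∧ (e ⊆ᵇ t)) (triangles n))) (edges n))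
    ≡⟨ parity-cong (λ e → sym (parity-scaleˡ (H e) _ (triangles n))) (edges n) ⟩
  parity (map (λ e → parity (map (λ t → H e ∧ (S t ∧ (e ⊆ᵇ t))) (triangles n))) (edges n))
    ≡⟨ parity-swap (λ e t → H e ∧ (S t ∧ (e ⊆ᵇ t))) (edges n) (triangles n) ⟩
  parity (map (λ t → parity (map (λ e → H e ∧ (S t ∧ (e ⊆ᵇ t))) (edges n))) (triangles n))
    ≡⟨ parity-cong (λ t → trans (parity-cong (λ e → ∧-exchange (H e) (S t) (e ⊆ᵇ t)) (edges n))
                                 (parity-scaleˡ (S t) _ (edges n))) (triangles n) ⟩
  parity (map (λ t → S t ∧ δ H t) (triangles n)) ∎
  where open ≡-Reasoning

pairing-span : {n : ℕ} {A : TriSet n} {f : EdgeSet n} (H : EdgeSet n) → InSpan A f →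
  (∀ t → isTri t ≡ true → A t ≡ true → δ H t ≡ false) → ⟨ H , f ⟩ ≡ false
pairing-span {n} {f = f} H (S , S⊆A , f≡∂S) δH-vanishes =
  trans (pairing-∂ H S f f≡∂S) (trans (parity-cong-filter isTri term-vanishes (allSubsets n)) (parity-zero (triangles n)))
  where
  term-vanishes : ∀ t → isTri t ≡ true → S t ∧ δ H t ≡ false
  term-vanishes t t-tri with S t in St
  ... | false = refl
  ... | true  = δH-vanishes t t-tri (S⊆A t t-tri St)

InSpan-cong : {n : ℕ} {A : TriSet n} {f g : EdgeSet n} →
  (∀ e → isEdge e ≡ true → f e ≡ g e) → InSpan A f → InSpan A g
InSpan-cong f≗g (S , S⊆A , f≡∂S) = S , S⊆A , λ e e-edge → trans (sym (f≗g e e-edge)) (f≡∂S e e-edge)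

InSpan-zero : {n : ℕ} (A : TriSet n) → InSpan A (λ _ → false)
InSpan-zero {n} A = (λ _ → false) , (λ _ _ ()) , λ _ _ → sym (parity-zero (triangles n))

InSpan-xor : {n : ℕ} {A : TriSet n} {f g : EdgeSet n} → InSpan A f → InSpan A g → InSpan A (λ e → f e xor g e)
InSpan-xor {n} {A} {f} {g} (S₁ , S₁⊆A , f≡∂S₁) (S₂ , S₂⊆A , g≡∂S₂) = S , S⊆A , f+g≡∂S
  where
  S : TriSet n
  S t = S₁ t xor S₂ t
  S⊆A : (t : Subset n) → isTri t ≡ true → S t ≡ true → A t ≡ true
  S⊆A t t-tri St with S₁ t in S₁t
  ... | true  = S₁⊆A t t-tri S₁t
  ... | false = S₂⊆A t t-tri St
  f+g≡∂S : (e : Subset n) → isEdge e ≡ true → f e xor g e ≡ parity (map (λ t → S t ∧ (e ⊆ᵇ t)) (triangles n))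
  f+g≡∂S e e-edge = trans (cong₂ _xor_ (f≡∂S₁ e e-edge) (g≡∂S₂ e e-edge)) (sym
    (trans (parity-cong (λ t → ∧-distribʳ-xor (e ⊆ᵇ t) (S₁ t) (S₂ t)) (triangles n)) (parity-xor _ _ (triangles n))))

InSpan-sum : {n : ℕ} {A : TriSet n} {f : EdgeSet n} (Q : List (Subset n)) →
  All (λ q → isTri q ≡ true × A q ≡ true) Q →
  (∀ e → isEdge e ≡ true → f e ≡ parity (map (λ q → e ⊆ᵇ q) Q)) → InSpan A f
InSpan-sum {n} {A} {f} Q Q⊆A f≡∂Q = S , S⊆A , f≡∂S
  where
  S : TriSet n
  S t = parity (map (t ==_) Q)
  S⊆A : (t : Subset n) → isTri t ≡ true → S t ≡ true → A t ≡ true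
  S⊆A t _ St with parity-witness (t ==_) Q St
  ... | q , q∈Q , t==q = subst (λ s → A s ≡ true) (sym (==⇒≡ t==q)) (proj₂ (All.lookup Q⊆A q∈Q))
  f≡∂S : (e : Subset n) → isEdge e ≡ true → f e ≡ parity (map (λ t → S t ∧ (e ⊆ᵇ t)) (triangles n))
  f≡∂S e e-edge = trans (f≡∂Q e e-edge) (sym (begin
    parity (map (λ t → S t ∧ (e ⊆ᵇ t)) (triangles n))
      ≡⟨ parity-cong (λ t → sym (parity-scaleʳ (e ⊆ᵇ t) (t ==_) Q)) (triangles n) ⟩
    parity (map (λ t → parity (map (λ q → (t == q) ∧ (e ⊆ᵇ t)) Q)) (triangles n))
      ≡⟨ parity-swap (λ t q → (t == q) ∧ (e ⊆ᵇ t)) (triangles n) Q ⟩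
    parity (map (λ q → parity (map (λ t → (t == q) ∧ (e ⊆ᵇ t)) (triangles n))) Q)
      ≡⟨ pick-all Q⊆A ⟩
    parity (map (λ q → e ⊆ᵇ q) Q) ∎))
    where
    open ≡-Reasoning
    pick-all : {Q′ : List (Subset n)} → All (λ q → isTri q ≡ true × A q ≡ true) Q′ →
      parity (map (λ q → parity (map (λ t → (t == q) ∧ (e ⊆ᵇ t)) (triangles n))) Q′) ≡ parity (map (λ q → e ⊆ᵇ q) Q′)
    pick-all []                    = refl
    pick-all {q ∷ _} ((q-tri , _) ∷ rest) =
      cong₂ _xor_ (pick-filtered isTri q q-tri (e ⊆ᵇ_)) (pick-all rest)

HomEquiv-refl : {n : ℕ} (A : TriSet n) (σ : Subset n) → HomEquiv A σ σ
HomEquiv-refl A σ = InSpan-cong (λ e _ → sym (xor-same (∂ σ e))) (InSpan-zero A)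

HomEquiv-sym : {n : ℕ} {A : TriSet n} {σ τ : Subset n} → HomEquiv A σ τ → HomEquiv A τ σ
HomEquiv-sym {σ = σ} {τ} = InSpan-cong (λ e _ → xor-comm (∂ σ e) (∂ τ e))

HomEquiv-trans : {n : ℕ} {A : TriSet n} {σ τ ρ : Subset n} → HomEquiv A σ τ → HomEquiv A τ ρ → HomEquiv A σ ρ
HomEquiv-trans {σ = σ} {τ} {ρ} σ∼τ τ∼ρ =
  InSpan-cong (λ e _ → xor-telescope (∂ σ e) (∂ τ e) (∂ ρ e)) (InSpan-xor σ∼τ τ∼ρ)

HomEquiv-inside : {n : ℕ} {A : TriSet n} {σ τ : Subset n} → isTri σ ≡ true → isTri τ ≡ true →
  A σ ≡ true → A τ ≡ true → HomEquiv A σ τ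
HomEquiv-inside {σ = σ} {τ} σ-tri τ-tri Aσ Aτ =
  InSpan-sum (σ ∷ τ ∷ []) ((σ-tri , Aσ) ∷ (τ-tri , Aτ) ∷ []) (λ e _ → cong (∂ σ e xor_) (sym (xor-identityʳ _)))

-- The boundary of the boundary of the tetrahedron pqrs vanishes.
∂-tetrahedron : {n : ℕ} {p q r s : Fin n} → p ≢ q → q ≢ r → p ≢ r → q ≢ s → p ≢ s → r ≢ s →
  ∀ e → isEdge e ≡ true → ∂ (tri p q r) e xor ∂ (tri p q s) e ≡ ∂ (tri p r s) e xor ∂ (tri q r s) e
∂-tetrahedron {p = p} {q} {r} {s} p≢q q≢r p≢r q≢s p≢s r≢s e e-edge
  rewrite ∂-tri e e-edge p≢q q≢r p≢r | ∂-tri e e-edge p≢q q≢s p≢s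
        | ∂-tri e e-edge p≢r r≢s p≢s | ∂-tri e e-edge q≢r r≢s q≢s =
  faces (e == edge p q) (e == edge q r) (e == edge p r) (e == edge q s) (e == edge p s) (e == edge r s)
  where
  faces : ∀ pq qr pr qs ps rs → (pq xor qr xor pr) xor (pq xor qs xor ps) ≡ (pr xor rs xor ps) xor (qr xor rs xor qs)
  faces = identity 6 _ _ refl

tetrahedron-swap : {n : ℕ} {A : TriSet n} {p q r s : Fin n} → p ≢ q → q ≢ r → p ≢ r → q ≢ s → p ≢ s → r ≢ s →
  HomEquiv A (tri p r s) (tri q r s) → HomEquiv A (tri p q r) (tri p q s)
tetrahedron-swap p≢q q≢r p≢r q≢s p≢s r≢s =
  InSpan-cong (λ e e-edge → sym (∂-tetrahedron p≢q q≢r p≢r q≢s p≢s r≢s e e-edge))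

count : {X : Set} → (X → Bool) → List X → ℕ
count p []       = 0
count p (x ∷ xs) = if p x then suc (count p xs) else count p xs

count≤length : {X : Set} (p : X → Bool) (xs : List X) → count p xs ≤ length xs
count≤length p []       = z≤n
count≤length p (x ∷ xs) with p x
... | true  = s≤s (count≤length p xs)
... | false = m≤n⇒m≤1+n (count≤length p xs)

count-mono : {X : Set} (p q : X → Bool) → (∀ x → p x ≡ true → q x ≡ true) → (xs : List X) → count p xs ≤ count q xs
count-mono p q p⊆q []       = z≤n
count-mono p q p⊆q (x ∷ xs) with p x in px | q x in qx
... | true  | true  = s≤s (count-mono p q p⊆q xs)
... | true  | false = ⊥-elim (false≢true (trans (sym qx) (p⊆q x px)))
... | false | true  = m≤n⇒m≤1+n (count-mono p q p⊆q xs)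
... | false | false = count-mono p q p⊆q xs

stable-or-grows : {X : Set} (p q : X → Bool) → (∀ x → p x ≡ true → q x ≡ true) → (xs : List X) →
  (∀ x → x ∈ xs → q x ≡ true → p x ≡ true) ⊎ (count p xs < count q xs)
stable-or-grows p q p⊆q [] = inj₁ (λ _ ())
stable-or-grows p q p⊆q (x ∷ xs) with p x in px | q x in qx | stable-or-grows p q p⊆q xs
... | true  | false | _        = ⊥-elim (false≢true (trans (sym qx) (p⊆q x px)))
... | false | true  | _        = inj₂ (s≤s (count-mono p q p⊆q xs))
... | true  | true  | inj₂ lt  = inj₂ (s≤s lt)
... | false | false | inj₂ lt  = inj₂ lt
... | true  | true  | inj₁ q⊆p = inj₁ λ { y (here refl) _ → px ; y (there y∈xs) → q⊆p y y∈xs }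
... | false | false | inj₁ q⊆p = inj₁ λ { y (here refl) qy → ⊥-elim (false≢true (trans (sym qx) qy))
                                       ; y (there y∈xs) → q⊆p y y∈xs }

stabilizes : {X : Set} (xs : List X) (P : ℕ → X → Bool) → (∀ k x → P k x ≡ true → P (suc k) x ≡ true) →
  Σ ℕ λ k → ∀ x → x ∈ xs → P (suc k) x ≡ true → P k x ≡ true
stabilizes xs P increasing with search (suc (length xs))
  where
  Stationary : ℕ → Set
  Stationary k = ∀ x → x ∈ xs → P (suc k) x ≡ true → P k x ≡ true
  search : (k : ℕ) → (Σ ℕ Stationary) ⊎ (k ≤ count (P k) xs)
  search zero = inj₂ z≤n
  search (suc k) with search k
  ... | inj₁ found = inj₁ found
  ... | inj₂ k≤count with stable-or-grows (P k) (P (suc k)) (increasing k) xs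
  ...   | inj₁ stationary = inj₁ (k , stationary)
  ...   | inj₂ grows      = inj₂ (≤-trans (s≤s k≤count) grows)
... | inj₁ found = found
... | inj₂ too-many = ⊥-elim (<-irrefl refl (≤-trans too-many (count≤length (P (suc (length xs))) xs)))

module Reachability {X : Set} (_≟_ : DecidableEquality X) (universe : List X) (universal : ∀ x → x ∈ universe)
                    {R : X → X → Set} (R? : ∀ x y → Dec (R x y)) where

  -- `reach k x y`: y is reachable from x in at most k steps
  reach : ℕ → X → X → Bool
  reach zero    x y = does (x ≟ y)
  reach (suc k) x y = reach k x y ∨ any (λ z → reach k x z ∧ does (R? z y)) universe

  any-witness : (f : X → Bool) (zs : List X) → any f zs ≡ true → Σ X λ z → f z ≡ true
  any-witness f []       ()
  any-witness f (z ∷ zs) any-f with f z in fz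
  ... | true  = z , fz
  ... | false = any-witness f zs any-f

  any-intro : (f : X → Bool) {zs : List X} {z : X} → z ∈ zs → f z ≡ true → any f zs ≡ true
  any-intro f (here refl)  fz rewrite fz = refl
  any-intro f {z′ ∷ _} (there z∈zs) fz rewrite any-intro f z∈zs fz = Bool.∨-zeroʳ (f z′)

  reach-sound : ∀ k x y → reach k x y ≡ true → Star R x y
  reach-sound zero    x y eq with x ≟ y
  ... | yes refl = ε
  reach-sound (suc k) x y eq with reach k x y in r
  ... | true  = reach-sound k x y r
  ... | false with any-witness _ universe eq
  ...   | z , r∧step = reach-sound k x z (∧-conicalˡ _ _ r∧step) ◅◅ (witness (R? z y) (∧-conicalʳ _ _ r∧step) ◅ ε)
    where
    witness : {P : Set} (p? : Dec P) → does p? ≡ true → P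
    witness (yes p) _ = p

  reach-mono : ∀ k x y → reach k x y ≡ true → reach (suc k) x y ≡ true
  reach-mono k x y r rewrite r = refl

  star? : ∀ x y → Dec (Star R x y)
  star? x y with stabilizes universe (λ k → reach k x) (λ k → reach-mono k x)
  ... | k , stationary with reach k x y in r
  ...   | true  = yes (reach-sound k x y r)
  ...   | false = no λ path → false≢true (trans (sym r) (complete path (start k)))
    where
    start : ∀ j → reach j x x ≡ true
    start zero    = dec-true (x ≟ x) refl
    start (suc j) = reach-mono j x x (start j)
    -- at a stationary stage the reachable set is closed under R
    complete : ∀ {z w} → Star R z w → reach k x z ≡ true → reach k x w ≡ true
    complete ε             rz = rz
    complete {z} (s ◅ path) rz = complete path (stationary _ (universal _)
      (trans (cong (reach k x _ ∨_) (any-intro _ (universal z) (cong₂ _∧_ rz (dec-true (R? z _) s))))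
             (Bool.∨-zeroʳ _)))

VStep-sym : {n : ℕ} {G : EdgeSet n} {e f : Subset n} → VStep G e f → VStep G f e
VStep-sym {G = G} (u , x , y , u≢x , u≢y , x≢y , e≡ux , f≡uy , Ge , Gf , Gxy) =
  u , y , x , u≢y , u≢x , ≢-sym x≢y , f≡uy , e≡ux , Gf , Ge , trans (cong G (edge-sym y x)) Gxy

VStep? : {n : ℕ} (G : EdgeSet n) (e f : Subset n) → Dec (VStep G e f)
VStep? G e f = Fin.any? λ u → Fin.any? λ x → Fin.any? λ y →
  ¬? (u Fin.≟ x) ×-dec ¬? (u Fin.≟ y) ×-dec ¬? (x Fin.≟ y) ×-dec
  e ≟ˢ edge u x ×-dec f ≟ˢ edge u y ×-dec
  G e Bool.≟ true ×-dec G f Bool.≟ true ×-dec G (edge x y) Bool.≟ false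

VEquivalent-inside : {n : ℕ} {G : EdgeSet n} {e f : Subset n} → VEquivalent G e f → G e ≡ true → G f ≡ true
VEquivalent-inside ε                                              Ge = Ge
VEquivalent-inside ((_ , _ , _ , _ , _ , _ , _ , _ , _ , Gf , _) ◅ path) _ = VEquivalent-inside path Gf

-- If K ⊆ G is a union of V-equivalence classes of G, then δK ⊆ δG: a triangle with exactly two
-- sides in G has them one V-step apart, so K contains both or neither of them.
δ-V-closed : {n : ℕ} (G K : EdgeSet n) → (∀ e → K e ≡ true → G e ≡ true) →
  (∀ {e f} → VStep G e f → K e ≡ K f) → ∀ t → isTri t ≡ true → δ K t ≡ true → δ G t ≡ true
δ-V-closed G K K⊆G closed t t-tri δKt with triangle-view t t-tri
... | triangleView a b c a≢b b≢c a≢c refl =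
  trans (δ-tri G a≢b b≢c a≢c) (sides (G (edge a b)) (G (edge b c)) (G (edge a c)) refl refl refl)
  where
  δK : K (edge a b) xor K (edge b c) xor K (edge a c) ≡ true
  δK = trans (sym (δ-tri K a≢b b≢c a≢c)) δKt
  impossible : {A : Set} → K (edge a b) xor K (edge b c) xor K (edge a c) ≡ false → A
  impossible even = ⊥-elim (false≢true (trans (sym even) δK))
  outside : ∀ {e} → G e ≡ false → K e ≡ false
  outside {e} Ge with K e in Ke
  ... | false = refl
  ... | true  = ⊥-elim (false≢true (trans (sym Ge) (K⊆G e Ke)))
  cancel₁₂ : ∀ k → k xor k xor false ≡ false
  cancel₁₂ = identity 1 _ _ refl
  cancel₁₃ : ∀ k → k xor false xor k ≡ false
  cancel₁₃ = identity 1 _ _ refl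
  cancel₂₃ : ∀ k → false xor k xor k ≡ false
  cancel₂₃ = identity 1 _ _ refl
  sides : (x y z : Bool) → G (edge a b) ≡ x → G (edge b c) ≡ y → G (edge a c) ≡ z → x xor y xor z ≡ true
  sides true  false false _ _ _ = refl
  sides false true  false _ _ _ = refl
  sides false false true  _ _ _ = refl
  sides true  true  true  _ _ _ = refl
  sides false false false ab bc ac = impossible (cong₂ _xor_ (outside ab) (cong₂ _xor_ (outside bc) (outside ac)))
  sides true  true  false ab bc ac = impossible (trans (cong₂ (λ y z → K (edge a b) xor y xor z) (sym ab∼bc) (outside ac))
                                                       (cancel₁₂ (K (edge a b))))
    where
    ab∼bc : K (edge a b) ≡ K (edge b c)
    ab∼bc = trans (cong K (edge-sym a b))
      (closed (b , a , c , ≢-sym a≢b , b≢c , a≢c , refl , refl , trans (cong G (edge-sym b a)) ab , bc , ac))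
  sides true  false true  ab bc ac = impossible (trans (cong₂ (λ y z → K (edge a b) xor y xor z) (outside bc) (sym ab∼ac))
                                                       (cancel₁₃ (K (edge a b))))
    where
    ab∼ac : K (edge a b) ≡ K (edge a c)
    ab∼ac = closed (a , b , c , a≢b , a≢c , b≢c , refl , refl , ab , ac , bc)
  sides false true  true  ab bc ac = impossible (trans (cong₂ (λ x z → x xor K (edge b c) xor z) (outside ab) (sym bc∼ac))
                                                       (cancel₂₃ (K (edge b c))))
    where
    bc∼ac : K (edge b c) ≡ K (edge a c)
    bc∼ac = trans (cong K (edge-sym b c)) (trans
      (closed (c , b , a , ≢-sym b≢c , ≢-sym a≢c , ≢-sym a≢b , refl , refl ,
               trans (cong G (edge-sym c b)) bc , trans (cong G (edge-sym c a)) ac , trans (cong G (edge-sym b a)) ab))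
      (cong K (edge-sym c a)))

module LinkAt {n : ℕ} (B : TriSet n) (v : Fin n) where

  L : EdgeSet n
  L = Link v B

  link-apex : (x : Fin n) → L (edge x v) ≡ false
  link-apex x = trans (cong (λ b → isEdge (edge x v) ∧ not b ∧ B (edge x v ∪ ⁅ v ⁆)) v∈xv) (∧-zeroʳ _)
    where
    v∈xv : lookup (edge x v) v ≡ true
    v∈xv = trans (cong (λ s → lookup s v) (edge-sym x v)) (lookup-self v ⁅ x ⁆)

  link-value : {a b : Fin n} → a ≢ b → a ≢ v → b ≢ v → L (edge a b) ≡ B (tri a b v)
  link-value {a} {b} a≢b a≢v b≢v =
    trans (cong₂ (λ x y → x ∧ not y ∧ B (edge a b ∪ ⁅ v ⁆)) (isEdge-edge a≢b)
                 (trans (lookup-edge a b v) (cong₂ _∨_ (=ᶠ-≢ a≢v) (=ᶠ-≢ b≢v))))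
          (cong B (cone a b v))

  link-isEdge : (e : Subset n) → L e ≡ true → isEdge e ≡ true
  link-isEdge e Le = ∧-conicalˡ _ _ Le

  link-avoids : (a b : Fin n) → L (edge a b) ≡ true → a ≢ v × b ≢ v
  link-avoids a b Lab = a≢v , b≢v
    where
    a≢v : a ≢ v
    a≢v refl = false≢true (trans (sym (link-apex b)) (trans (cong L (edge-sym b a)) Lab))
    b≢v : b ≢ v
    b≢v refl = false≢true (trans (sym (link-apex a)) Lab)

  record LinkEdge (e : Subset n) : Set where
    constructor linkEdge
    field
      a b   : Fin n
      a≢b   : a ≢ b
      a≢v   : a ≢ v
      b≢v   : b ≢ v
      shape : e ≡ edge a b

  link-edge : (e : Subset n) → L e ≡ true → LinkEdge e
  link-edge e Le with edge-view e (link-isEdge e Le)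
  ... | a , b , a≢b , refl = linkEdge a b a≢b (proj₁ (link-avoids a b Le)) (proj₂ (link-avoids a b Le)) refl

  δ-cone : (H : EdgeSet n) → (∀ x → H (edge x v) ≡ false) → {a b : Fin n} → a ≢ b → a ≢ v → b ≢ v →
    δ H (tri a b v) ≡ H (edge a b)
  δ-cone H apex-free {a} {b} a≢b a≢v b≢v =
    trans (δ-tri H a≢b b≢v a≢v) (trans (cong₂ (λ y z → H (edge a b) xor y xor z) (apex-free b) (apex-free a))
                                        (xor-identityʳ _))

  data Position (t : Subset n) : Set where
    through  : (a b : Fin n) → a ≢ b → a ≢ v → b ≢ v → t ≡ tri a b v → Position t
    avoiding : (a b c : Fin n) → a ≢ b → b ≢ c → a ≢ c → a ≢ v → b ≢ v → c ≢ v → t ≡ tri a b c → Position t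

  position : (t : Subset n) → isTri t ≡ true → Position t
  position t t-tri with triangle-view t t-tri
  ... | triangleView a b c a≢b b≢c a≢c t≡abc with v Fin.≟ a
  ...   | yes refl = through b c b≢c (≢-sym a≢b) (≢-sym a≢c)
                       (trans t≡abc (trans (tri-swap₁₂ v b c) (tri-swap₂₃ b v c)))
  ...   | no v≢a with v Fin.≟ b
  ...     | yes refl = through a c a≢c a≢b (≢-sym b≢c) (trans t≡abc (tri-swap₂₃ a v c))
  ...     | no v≢b with v Fin.≟ c
  ...       | yes refl = through a b a≢b a≢c b≢c t≡abc
  ...       | no v≢c = avoiding a b c a≢b b≢c a≢c (≢-sym v≢a) (≢-sym v≢b) (≢-sym v≢c) t≡abc

  link-coboundary : Is2Coboundary B → ∀ t → isTri t ≡ true → B t ≡ δ L t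
  link-coboundary (G , B≡δG) t t-tri with position t t-tri
  ... | through a b a≢b a≢v b≢v refl =
    trans (sym (link-value a≢b a≢v b≢v)) (sym (δ-cone L link-apex a≢b a≢v b≢v))
  ... | avoiding a b c a≢b b≢c a≢c a≢v b≢v c≢v refl = begin
    B (tri a b c)
      ≡⟨ trans (B≡δG _ t-tri) (δ-tri G a≢b b≢c a≢c) ⟩
    G (edge a b) xor G (edge b c) xor G (edge a c)
      ≡⟨ expand (G (edge a b)) (G (edge b c)) (G (edge a c)) (G (edge a v)) (G (edge b v)) (G (edge c v)) ⟩
    (G (edge a b) xor G (edge b v) xor G (edge a v)) xor (G (edge b c) xor G (edge c v) xor G (edge b v))
      xor (G (edge a c) xor G (edge c v) xor G (edge a v))
      ≡⟨ sym (cong₂ _xor_ (link-via-G a≢b a≢v b≢v) (cong₂ _xor_ (link-via-G b≢c b≢v c≢v) (link-via-G a≢c a≢v c≢v))) ⟩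
    L (edge a b) xor L (edge b c) xor L (edge a c)
      ≡⟨ sym (δ-tri L a≢b b≢c a≢c) ⟩
    δ L (tri a b c) ∎
    where
    open ≡-Reasoning
    link-via-G : {x y : Fin n} → x ≢ y → x ≢ v → y ≢ v → L (edge x y) ≡ G (edge x y) xor G (edge y v) xor G (edge x v)
    link-via-G x≢y x≢v y≢v =
      trans (link-value x≢y x≢v y≢v) (trans (B≡δG _ (isTri-tri x≢y y≢v x≢v)) (δ-tri G x≢y y≢v x≢v))
    -- each edge through v occurs in exactly two of the three cone triangles
    expand : ∀ ab bc ac av bv cv →
      ab xor bc xor ac ≡ (ab xor bv xor av) xor (bc xor cv xor bv) xor (ac xor cv xor av)
    expand = identity 6 _ _ refl

  cone-in-B : (e : Subset n) → L e ≡ true → isTri (e ∪ ⁅ v ⁆) ≡ true × B (e ∪ ⁅ v ⁆) ≡ true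
  cone-in-B e Le with link-edge e Le
  ... | linkEdge a b a≢b a≢v b≢v refl =
    subst (λ t → isTri t ≡ true) (sym (cone a b v)) (isTri-tri a≢b b≢v a≢v) ,
    trans (cong B (cone a b v)) (trans (sym (link-value a≢b a≢v b≢v)) Le)

  δ-cone-over : (H : EdgeSet n) → (∀ x → H (edge x v) ≡ false) → (e : Subset n) → L e ≡ true →
    δ H (e ∪ ⁅ v ⁆) ≡ H e
  δ-cone-over H apex-free e Le with link-edge e Le
  ... | linkEdge a b a≢b a≢v b≢v refl = trans (cong (δ H) (cone a b v)) (δ-cone H apex-free a≢b a≢v b≢v)

-- A triangle of a coboundary δH is never null homologous relative to the complement:
-- the pairing with H vanishes on that span but detects the triangle.
coboundary-not-null : {n : ℕ} {B : TriSet n} (H : EdgeSet n) → (∀ t → isTri t ≡ true → B t ≡ δ H t) →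
  (σ : Subset n) → isTri σ ≡ true → B σ ≡ true → ¬ NullHomologous (complementT B) σ
coboundary-not-null {B = B} H B≡δH σ σ-tri Bσ null =
  false≢true (trans (sym (pairing-span H null δH-outside)) (trans (sym (B≡δH σ σ-tri)) Bσ))
  where
  δH-outside : ∀ t → isTri t ≡ true → not (B t) ≡ true → δ H t ≡ false
  δH-outside t t-tri t∉B with B t in Bt
  ... | false = trans (sym (B≡δH t t-tri)) Bt

module Criterion {n : ℕ} (B : TriSet n) (v : Fin n) (B≡δL : ∀ t → isTri t ≡ true → B t ≡ δ (Link v B) t) where

  open LinkAt B v
  open Reachability _≟ˢ_ (allSubsets n) allSubsets-complete (VStep? L) using (star?)

  A : TriSet n
  A = complementT B

  outside : {t : Subset n} → B t ≡ false → A t ≡ true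
  outside = cong not

  B-avoiding : {a b c : Fin n} → a ≢ b → b ≢ c → a ≢ c →
    B (tri a b c) ≡ L (edge a b) xor L (edge b c) xor L (edge a c)
  B-avoiding a≢b b≢c a≢c = trans (B≡δL _ (isTri-tri a≢b b≢c a≢c)) (δ-tri L a≢b b≢c a≢c)

  -- A V-step of the link moves the cone over it within its homology class: in the
  -- tetrahedron uxyv the faces uxy and xyv lie outside B.
  step-homologous : {e f : Subset n} → VStep L e f → HomEquiv A (e ∪ ⁅ v ⁆) (f ∪ ⁅ v ⁆)
  step-homologous (u , x , y , u≢x , u≢y , x≢y , refl , refl , Lux , Luy , Lxy) =
    subst₂ (HomEquiv A) (sym (trans (cone u x v) (tri-swap₂₃ u x v))) (sym (trans (cone u y v) (tri-swap₂₃ u y v)))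
      (tetrahedron-swap u≢v (≢-sym x≢v) u≢x (≢-sym y≢v) u≢y x≢y
        (HomEquiv-inside (isTri-tri u≢x x≢y u≢y) (isTri-tri (≢-sym x≢v) x≢y (≢-sym y≢v)) uxy∉B vxy∉B))
    where
    u≢v = proj₁ (link-avoids u x Lux)
    x≢v = proj₂ (link-avoids u x Lux)
    y≢v = proj₂ (link-avoids u y Luy)
    uxy∉B : A (tri u x y) ≡ true
    uxy∉B = outside (trans (B-avoiding u≢x x≢y u≢y) (cong₂ _xor_ Lux (cong₂ _xor_ Lxy Luy)))
    vxy∉B : A (tri v x y) ≡ true
    vxy∉B = outside (trans (cong B (trans (tri-swap₁₂ v x y) (tri-swap₂₃ x v y)))
                           (trans (sym (link-value x≢y x≢v y≢v)) Lxy))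

  VEquivalent-homologous : {e f : Subset n} → VEquivalent L e f → HomEquiv A (e ∪ ⁅ v ⁆) (f ∪ ⁅ v ⁆)
  VEquivalent-homologous ε             = HomEquiv-refl A _
  VEquivalent-homologous (step ◅ path) = HomEquiv-trans (step-homologous step) (VEquivalent-homologous path)

  to-cone : {p q r : Fin n} → p ≢ q → q ≢ r → p ≢ r → p ≢ v → q ≢ v → r ≢ v →
    HomEquiv A (edge p r ∪ ⁅ v ⁆) (edge q r ∪ ⁅ v ⁆) → HomEquiv A (tri p q r) (edge p q ∪ ⁅ v ⁆)
  to-cone {p} {q} {r} p≢q q≢r p≢r p≢v q≢v r≢v cones =
    subst (HomEquiv A (tri p q r)) (sym (cone p q v))
      (tetrahedron-swap p≢q q≢r p≢r q≢v p≢v r≢v (subst₂ (HomEquiv A) (cone p r v) (cone q r v) cones))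

  cones-outside : {p q r : Fin n} → p ≢ r → q ≢ r → p ≢ v → q ≢ v → r ≢ v →
    L (edge p r) ≡ false → L (edge q r) ≡ false → HomEquiv A (edge p r ∪ ⁅ v ⁆) (edge q r ∪ ⁅ v ⁆)
  cones-outside {p} {q} {r} p≢r q≢r p≢v q≢v r≢v Lpr Lqr =
    subst₂ (HomEquiv A) (sym (cone p r v)) (sym (cone q r v))
      (HomEquiv-inside (isTri-tri p≢r r≢v p≢v) (isTri-tri q≢r r≢v q≢v)
        (outside (trans (sym (link-value p≢r p≢v r≢v)) Lpr)) (outside (trans (sym (link-value q≢r q≢v r≢v)) Lqr)))

  cone-representative : VConnected L → (σ : Subset n) → isTri σ ≡ true → B σ ≡ true →
    Σ (Subset n) λ e → L e ≡ true × HomEquiv A σ (e ∪ ⁅ v ⁆)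
  cone-representative connected σ σ-tri Bσ with position σ σ-tri
  ... | through a b a≢b a≢v b≢v refl =
    edge a b , trans (link-value a≢b a≢v b≢v) Bσ , subst (HomEquiv A σ) (sym (cone a b v)) (HomEquiv-refl A σ)
  ... | avoiding a b c a≢b b≢c a≢c a≢v b≢v c≢v refl =
    sides (L (edge a b)) (L (edge b c)) (L (edge a c)) refl refl refl (trans (sym (B-avoiding a≢b b≢c a≢c)) Bσ)
    where
    Lba = cong L (edge-sym b a)
    Lcb = cong L (edge-sym c b)
    Lca = cong L (edge-sym c a)
    sides : (x y z : Bool) → L (edge a b) ≡ x → L (edge b c) ≡ y → L (edge a c) ≡ z → x xor y xor z ≡ true →
      Σ (Subset n) λ e → L e ≡ true × HomEquiv A (tri a b c) (e ∪ ⁅ v ⁆)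
    sides true false false ab bc ac _ =
      edge a b , ab , to-cone a≢b b≢c a≢c a≢v b≢v c≢v (cones-outside a≢c b≢c a≢v b≢v c≢v ac bc)
    sides false true false ab bc ac _ =
      edge b c , bc , subst (λ t → HomEquiv A t (edge b c ∪ ⁅ v ⁆)) (sym (trans (tri-swap₁₂ a b c) (tri-swap₂₃ b a c)))
        (to-cone b≢c (≢-sym a≢c) (≢-sym a≢b) b≢v c≢v a≢v
          (cones-outside (≢-sym a≢b) (≢-sym a≢c) b≢v c≢v a≢v (trans Lba ab) (trans Lca ac)))
    sides false false true ab bc ac _ =
      edge a c , ac , subst (λ t → HomEquiv A t (edge a c ∪ ⁅ v ⁆)) (sym (tri-swap₂₃ a b c))
        (to-cone a≢c (≢-sym b≢c) a≢b a≢v c≢v b≢v (cones-outside a≢b (≢-sym b≢c) a≢v c≢v b≢v ab (trans Lcb bc)))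
    sides true true true ab bc ac _ =
      edge a b , ab , to-cone a≢b b≢c a≢c a≢v b≢v c≢v
        (VEquivalent-homologous (connected (edge a c) (edge b c) (isEdge-edge a≢c) (isEdge-edge b≢c) ac bc))
    sides false false false _ _ _ ()
    sides true  true  false _ _ _ ()
    sides true  false true  _ _ _ ()
    sides false true  true  _ _ _ ()

  hypercut-of-V-connected : NonemptyT B → VConnected L → Is2Hypercut B
  hypercut-of-V-connected nonempty connected = nonempty , coboundary-not-null L B≡δL , homologous
    where
    homologous : (σ₁ σ₂ : Subset n) → isTri σ₁ ≡ true → isTri σ₂ ≡ true → B σ₁ ≡ true → B σ₂ ≡ true →
      HomEquiv A σ₁ σ₂
    homologous σ₁ σ₂ σ₁-tri σ₂-tri Bσ₁ Bσ₂
      with cone-representative connected σ₁ σ₁-tri Bσ₁ | cone-representative connected σ₂ σ₂-tri Bσ₂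
    ... | e₁ , Le₁ , σ₁∼e₁ | e₂ , Le₂ , σ₂∼e₂ =
      HomEquiv-trans σ₁∼e₁ (HomEquiv-trans
        (VEquivalent-homologous (connected e₁ e₂ (link-isEdge e₁ Le₁) (link-isEdge e₂ Le₂) Le₁ Le₂)) (HomEquiv-sym σ₂∼e₂))

  -- Otherwise the
  -- V-class K of e misses f; δK ⊆ δL = B, so pairing with K kills the cycle ∂(e ∪ v) + ∂(f ∪ v),
  -- which lies in the span of the complement of B, while this pairing equals K e + K f = 1.
  V-connected-of-hypercut : Is2Hypercut B → VConnected L
  V-connected-of-hypercut (_ , _ , homologous) e f _ _ Le Lf with star? e f
  ... | yes path     = path
  ... | no  no-path = ⊥-elim (false≢true (trans (sym pairing-vanishes) pairing-detects))
    where
    K : EdgeSet n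
    K s = does (star? e s)
    K⊆L : ∀ s → K s ≡ true → L s ≡ true
    K⊆L s Ks with star? e s
    ... | yes path = VEquivalent-inside path Le
    K-closed : ∀ {x y} → VStep L x y → K x ≡ K y
    K-closed {x} {y} step =
      does-⇔ (mk⇔ (λ path → path ◅◅ (step ◅ ε)) (λ path → path ◅◅ (VStep-sym step ◅ ε))) (star? e x) (star? e y)
    K-apex : ∀ x → K (edge x v) ≡ false
    K-apex x with K (edge x v) in Kxv
    ... | false = refl
    ... | true  = ⊥-elim (false≢true (trans (sym (link-apex x)) (K⊆L _ Kxv)))
    δK-outside : ∀ t → isTri t ≡ true → A t ≡ true → δ K t ≡ false
    δK-outside t t-tri t∉B with δ K t in δKt
    ... | false = refl
    ... | true  = ⊥-elim (false≢true (trans (sym (cong not (trans (B≡δL t t-tri)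
                    (δ-V-closed L K K⊆L K-closed t t-tri δKt)))) t∉B))
    σe = e ∪ ⁅ v ⁆
    σf = f ∪ ⁅ v ⁆
    pairing-vanishes : ⟨ K , (λ s → ∂ σe s xor ∂ σf s) ⟩ ≡ false
    pairing-vanishes = pairing-span K
      (homologous σe σf (proj₁ (cone-in-B e Le)) (proj₁ (cone-in-B f Lf)) (proj₂ (cone-in-B e Le)) (proj₂ (cone-in-B f Lf)))
      δK-outside
    pairing-detects : ⟨ K , (λ s → ∂ σe s xor ∂ σf s) ⟩ ≡ true
    pairing-detects = trans (pairing-xor K (∂ σe) (∂ σf))
      (cong₂ _xor_ (trans (δ-cone-over K K-apex e Le) (dec-true (star? e e) ε))
                   (trans (δ-cone-over K K-apex f Lf) (dec-false (star? e f) no-path)))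

mainTheorem14 : (n : ℕ) (B : TriSet n) → Is2Coboundary B → NonemptyT B →
    (v : Fin n) → Is2Hypercut B ⇔ VConnected (Link v B)
mainTheorem14 n B coboundary nonempty v =
  mk⇔ V-connected-of-hypercut (hypercut-of-V-connected nonempty)
  where
  open Criterion B v (LinkAt.link-coboundary B v coboundary)
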